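{- Let $t,m,n$ be positive integers. If $\alpha=(a_1,\dots,a_m)\in[n]^m$ is a $t$-metered $(m,n)$-parking function, then for all $i\in[n]$ and all $j\in[m-t]$, $$|\{k: j\le k\le j+t,\ a_k\le i\}|\ \ge\ t+1-n+i.$$
   Context: $[n]=\{1,\dots,n\}$. The $t$-metered parking scheme for $\alpha\in[n]^m$: there are $n$ spots $1,\dots,n$ on a one-way street; cars $1,\dots,m$ arrive in order; car $i$ drives to spot $a_i$, parks there if it is unoccupied, and otherwise parks in the first unoccupied spot numbered greater than $a_i$; if there is none, the car fails to park. Immediately after car $j$ parks, car $j-t$ (if $j-t\ge1$) leaves, vacating its spot. $\alpha$ is a $t$-metered $(m,n)$-parking function if all $m$ cars park. -}

module Defs where

open import Data.Nat using (ℕ; zero; suc; _∸_; _≤_; _≤?_; _<ᵇ_; _≡ᵇ_)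
open import Data.Bool using (Bool; true; false; if_then_else_)
open import Data.Maybe using (Maybe; just; nothing)
open import Data.List using (List; []; _∷_; _++_; [_]; length; drop; filter)
open import Data.Bool.ListAction using (any)
open import Data.Vec using (Vec; toList; lookup)
open import Data.Fin using (Fin; toℕ)
open import Data.List using (allFin)
open import Relation.Nullary.Decidable using (_×-dec_)
open import Data.Product using (_×_)

-- Spots are 1..n, cars are 1..m (1-indexed as in the paper).

search : ℕ → ℕ → List ℕ → Maybe ℕ
search zero    s occ = nothing
search (suc k) s occ = if any (s ≡ᵇ_) occ then search k (suc s) occ else just s

firstFree : (n a : ℕ) → List ℕ → Maybe ℕ
firstFree n a occ = search (suc n ∸ a) a occ

-- The occupied spots are kept in arrival order (oldest first).  After a car
-- parks, if more than t cars are present, the oldest one (car j - t) leaves.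
evict : ℕ → List ℕ → List ℕ
evict t l = if t <ᵇ length l then drop 1 l else l

parks : (n t : ℕ) → List ℕ → List ℕ → Bool
parks n t occ [] = true
parks n t occ (a ∷ as) with firstFree n a occ
... | nothing = false
... | just s  = parks n t (evict t (occ ++ [ s ])) as

InRange : (n : ℕ) {m : ℕ} → Vec ℕ m → Set
InRange n {m} α = (k : Fin m) → 1 ≤ lookup α k × lookup α k ≤ n

IsMeteredPF : (t m n : ℕ) → Vec ℕ m → Set
IsMeteredPF t m n α = InRange n α × parks n t [] (toList α) ≡ true
  where open import Relation.Binary.PropositionalEquality using (_≡_)

windowCount : {m : ℕ} → Vec ℕ m → (t j i : ℕ) → ℕ
windowCount {m} α t j i =
  length (filter (λ k → (j ≤? suc (toℕ k)) ×-dec ((suc (toℕ k) ≤? j Data.Nat.+ t) ×-dec (lookup α k ≤? i)))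
                 (allFin m))

-- Among t + 1 consecutive cars j, ..., j + t none leaves before car j + t has parked
-- (car k leaves right after car k + t parks), so they occupy t + 1 distinct spots.
-- A car preferring a spot beyond i parks beyond i, and only n - i spots lie beyond i.
-- So at most n - i cars of the window prefer a spot beyond i, and at least
-- t + 1 - (n - i) of them prefer a spot at most i.

module Submission where

open import Defs

open import Data.Bool using (true; false; T)
open import Data.Bool.ListAction using (any)
open import Data.Fin as Fin using (Fin; toℕ)
open import Data.List using (List; []; _∷_; _++_; [_]; length; filter; map; applyUpTo; take; drop; tabulate; allFin)
open import Data.List.Properties using (length-++; ++-assoc; ++-identityʳ; length-applyUpTo; length-map; map-tabulate; filter-none; filter-≐)
open import Data.List.Membership.Propositional using (_∈_; _∉_)
open import Data.List.Membership.Propositional.Properties using (∈-∃++; ∈-++⁻; ∈-++⁺ˡ; ∈-++⁺ʳ; ∈-applyUpTo⁺)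
open import Data.List.Relation.Binary.Pointwise using (Pointwise; []; _∷_)
open import Data.List.Relation.Binary.Subset.Propositional using (_⊆_)
open import Data.List.Relation.Unary.All as All using (All; []; _∷_)
open import Data.List.Relation.Unary.All.Properties using (tabulate⁺; all-filter)
open import Data.List.Relation.Unary.Any as Any using (here; there)
open import Data.List.Relation.Unary.Any.Properties using (any⁺)
open import Data.List.Relation.Unary.Unique.Propositional using (Unique; []; _∷_)
import Data.List.Relation.Unary.Unique.Propositional.Properties as Unique
open import Data.Maybe using (just)
open import Data.Nat using (ℕ; zero; suc; _+_; _∸_; _≤_; _≰_; _<_; _≤?_; _<?_; _≡ᵇ_; _<ᵇ_; z≤n; s≤s; s≤s⁻¹; z<s)
open import Data.Nat.Properties
open import Data.Product using (_×_; _,_; ∃; proj₂)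
open import Data.Sum using (inj₁; inj₂)
open import Data.Vec using (Vec; []; _∷_; toList; lookup)
open import Data.Vec.Properties using (length-toList)
open import Function using (_∘_; id)
open import Level using (Level)
open import Relation.Binary.PropositionalEquality using (_≡_; refl; sym; trans; cong; subst; module ≡-Reasoning)
open import Relation.Nullary using (yes; no; does; contradiction)
open import Relation.Nullary.Decidable using (_×-dec_)
open import Relation.Unary using (Pred; Decidable; _≐_)
open import Relation.Unary.Properties using (∁?)

private
  variable
    a p q r : Level
    A B : Set a

module _ {P : Pred A p} (P? : Decidable P) where

  filter-map : (f : B → A) (xs : List B) → filter P? (map f xs) ≡ map f (filter (P? ∘ f) xs)
  filter-map f []       = refl
  filter-map f (x ∷ xs) with does (P? (f x))
  ... | true  = cong (f x ∷_) (filter-map f xs)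
  ... | false = filter-map f xs

  length-filter+length-filter-∁ : (xs : List A) →
    length (filter P? xs) + length (filter (∁? P?) xs) ≡ length xs
  length-filter+length-filter-∁ []       = refl
  length-filter+length-filter-∁ (x ∷ xs) with ih ← length-filter+length-filter-∁ xs | does (P? x)
  ... | true  = cong suc ih
  ... | false = trans (+-suc _ _) (cong suc ih)

module _ {P : Pred A p} {Q : Pred B q} {R : A → B → Set r} (P? : Decidable P) (Q? : Decidable Q) where

  length-filter-mono-Pointwise : (∀ {x y} → R x y → P x → Q y) →
    ∀ {xs ys} → Pointwise R xs ys → length (filter P? xs) ≤ length (filter Q? ys)
  length-filter-mono-Pointwise P⇒Q []                   = z≤n
  length-filter-mono-Pointwise P⇒Q (_∷_ {x} {y} Rxy Rs) with ih ← length-filter-mono-Pointwise P⇒Q Rs | P? x | Q? y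
  ... | yes _  | yes _  = s≤s ih
  ... | yes Px | no ¬Qy = contradiction (P⇒Q Rxy Px) ¬Qy
  ... | no _   | yes _  = m≤n⇒m≤1+n ih
  ... | no _   | no _   = ih

Pointwise-take : ∀ {R : A → B → Set r} k {xs ys} → Pointwise R xs ys → Pointwise R (take k xs) (take k ys)
Pointwise-take zero    _        = []
Pointwise-take (suc k) []       = []
Pointwise-take (suc k) (r ∷ rs) = r ∷ Pointwise-take k rs

length-take-drop : ∀ j k (xs : List A) → j + k ≤ length xs → length (take k (drop j xs)) ≡ k
length-take-drop zero    zero    xs       _         = refl
length-take-drop zero    (suc k) (x ∷ xs) (s≤s j+k≤) = cong suc (length-take-drop zero k xs j+k≤)
length-take-drop (suc j) k       (x ∷ xs) (s≤s j+k≤) = length-take-drop j k xs j+k≤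

Unique-∷ʳ : ∀ {x} {xs : List A} → x ∉ xs → Unique xs → Unique (xs ++ [ x ])
Unique-∷ʳ x∉xs uxs = Unique.++⁺ uxs ([] ∷ []) λ { (x∈xs , here refl) → x∉xs x∈xs }

unique-⊆⇒length≤ : {xs ys : List A} → Unique xs → xs ⊆ ys → length xs ≤ length ys
unique-⊆⇒length≤ [] _ = z≤n
unique-⊆⇒length≤ {xs = x ∷ xs} (x≢xs ∷ uxs) x∷xs⊆ys
  with us , vs , refl ← ∈-∃++ (x∷xs⊆ys (here refl)) = begin
  suc (length xs)             ≤⟨ s≤s (unique-⊆⇒length≤ uxs xs⊆us++vs) ⟩
  suc (length (us ++ vs))     ≡⟨ cong suc (length-++ us) ⟩
  suc (length us + length vs) ≡⟨ +-suc (length us) (length vs) ⟨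
  length us + length (x ∷ vs) ≡⟨ length-++ us ⟨
  length (us ++ x ∷ vs)       ∎
  where
  open ≤-Reasoning
  xs⊆us++vs : xs ⊆ us ++ vs
  xs⊆us++vs y∈xs with ∈-++⁻ us (x∷xs⊆ys (there y∈xs))
  ... | inj₁ y∈us         = ∈-++⁺ˡ y∈us
  ... | inj₂ (here refl)  = contradiction refl (All.lookup x≢xs y∈xs)
  ... | inj₂ (there y∈vs) = ∈-++⁺ʳ us y∈vs

∈-interval : ∀ {i n x} → i < x → x ≤ n → x ∈ applyUpTo (suc i +_) (n ∸ i)
∈-interval {i} {n} i<x x≤n =
  subst (_∈ applyUpTo (suc i +_) (n ∸ i)) (m+[n∸m]≡n i<x) (∈-applyUpTo⁺ (suc i +_) (∸-monoˡ-< (s≤s x≤n) i<x))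

unique-interval⇒length≤ : ∀ {i n} {xs : List ℕ} → Unique xs → All (λ x → i < x × x ≤ n) xs →
  length xs ≤ n ∸ i
unique-interval⇒length≤ {i} {n} {xs} uxs bounds = begin
  length xs                             ≤⟨ unique-⊆⇒length≤ uxs xs⊆interval ⟩
  length (applyUpTo (suc i +_) (n ∸ i)) ≡⟨ length-applyUpTo (suc i +_) (n ∸ i) ⟩
  n ∸ i                                 ∎
  where
  open ≤-Reasoning
  xs⊆interval : xs ⊆ applyUpTo (suc i +_) (n ∸ i)
  xs⊆interval x∈xs = let (i<x , x≤n) = All.lookup bounds x∈xs in ∈-interval i<x x≤n

length-filter-shift : ∀ {m} {P : Pred (Fin (suc m)) p} {R : Pred (Fin m) r} (P? : Decidable P) (R? : Decidable R) →
  (P ∘ Fin.suc) ≐ R → length (filter P? (tabulate Fin.suc)) ≡ length (filter R? (allFin m))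
length-filter-shift {m = m} P? R? P∘suc≐R = begin
  length (filter P? (tabulate Fin.suc))                   ≡⟨ cong (length ∘ filter P?) (map-tabulate id Fin.suc) ⟨
  length (filter P? (map Fin.suc (allFin m)))             ≡⟨ cong length (filter-map P? Fin.suc (allFin m)) ⟩
  length (map Fin.suc (filter (P? ∘ Fin.suc) (allFin m))) ≡⟨ length-map Fin.suc (filter (P? ∘ Fin.suc) (allFin m)) ⟩
  length (filter (P? ∘ Fin.suc) (allFin m))               ≡⟨ cong length (filter-≐ (P? ∘ Fin.suc) R? P∘suc≐R (allFin m)) ⟩
  length (filter R? (allFin m))                           ∎
  where open ≡-Reasoning

module _ {Q : Pred A q} (Q? : Decidable Q) where

  InSlice : ∀ {m} → ℕ → ℕ → Vec A m → Pred (Fin m) q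
  InSlice lo len α k = lo ≤ toℕ k × toℕ k < lo + len × Q (lookup α k)

  inSlice? : ∀ {m} lo len (α : Vec A m) → Decidable (InSlice lo len α)
  inSlice? lo len α k = (lo ≤? toℕ k) ×-dec ((toℕ k <? lo + len) ×-dec Q? (lookup α k))

  InSlice-take-suc : ∀ {m len} x (α : Vec A m) → (InSlice 0 (suc len) (x ∷ α) ∘ Fin.suc) ≐ InSlice 0 len α
  InSlice-take-suc _ _ =
    (λ (_ , k<len , q) → z≤n , s≤s⁻¹ k<len , q)
    , (λ (_ , k<len , q) → z≤n , s≤s k<len , q)

  InSlice-drop-suc : ∀ {m lo len} x (α : Vec A m) → (InSlice (suc lo) len (x ∷ α) ∘ Fin.suc) ≐ InSlice lo len α
  InSlice-drop-suc _ _ =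
    (λ (lo≤k , k<lo+len , q) → s≤s⁻¹ lo≤k , s≤s⁻¹ k<lo+len , q)
    , (λ (lo≤k , k<lo+len , q) → s≤s lo≤k , s≤s k<lo+len , q)

  length-filter-slice : ∀ {m} lo len (α : Vec A m) →
    length (filter (inSlice? lo len α) (allFin m)) ≡ length (filter Q? (take len (drop lo (toList α))))
  length-filter-slice lo       zero      []      = refl
  length-filter-slice zero     (suc len) []      = refl
  length-filter-slice (suc lo) (suc len) []      = refl
  length-filter-slice zero     zero      (x ∷ α) =
    cong length (filter-none (inSlice? 0 0 (x ∷ α)) (tabulate⁺ {f = id} λ _ (_ , k<0 , _) → n≮0 k<0))
  length-filter-slice zero     (suc len) (x ∷ α) with Q? x
  ... | yes _ = cong suc (trans (length-filter-shift _ (inSlice? 0 len α) (InSlice-take-suc x α))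
                                (length-filter-slice 0 len α))
  ... | no _  = trans (length-filter-shift _ (inSlice? 0 len α) (InSlice-take-suc x α))
                      (length-filter-slice 0 len α)
  length-filter-slice (suc lo) len       (x ∷ α) =
    trans (length-filter-shift _ (inSlice? lo len α) (InSlice-drop-suc x α)) (length-filter-slice lo len α)

-- windowCount numbers the cars from 1, list positions start at 0.
windowCount-slice : ∀ {m} (α : Vec ℕ m) t j i →
  windowCount α t (suc j) i ≡ length (filter (_≤? i) (take (suc t) (drop j (toList α))))
windowCount-slice {m} α t j i =
  trans (cong length (filter-≐ _ (inSlice? (_≤? i) j (suc t) α) window≐slice (allFin m)))
        (length-filter-slice (_≤? i) j (suc t) α)
  where
  window≐slice : (λ k → suc j ≤ suc (toℕ k) × suc (toℕ k) ≤ suc j + t × lookup α k ≤ i)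
                 ≐ InSlice (_≤? i) j (suc t) α
  window≐slice =
    (λ {k} (j≤k , k≤j+t , a≤i) → s≤s⁻¹ j≤k , subst (suc (toℕ k) ≤_) (sym (+-suc j t)) k≤j+t , a≤i)
    , (λ {k} (j≤k , k<j+1+t , a≤i) → s≤s j≤k , subst (suc (toℕ k) ≤_) (+-suc j t) k<j+1+t , a≤i)

window-in-range : ∀ {j m} t → suc j ≤ m ∸ t → j + suc t ≤ m
window-in-range {j} {m} t 1+j≤m∸t with t ≤? m
... | yes t≤m = subst (_≤ m) (sym (+-suc j t)) (m≤o∸n⇒m+n≤o (suc j) t≤m 1+j≤m∸t)
... | no  t≰m = contradiction (subst (suc j ≤_) (m≤n⇒m∸n≡0 (<⇒≤ (≰⇒> t≰m))) 1+j≤m∸t) λ ()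

any-≡ᵇ-false⇒∉ : ∀ {x xs} → any (x ≡ᵇ_) xs ≡ false → x ∉ xs
any-≡ᵇ-false⇒∉ {x} {xs} any≡false x∈xs =
  subst T any≡false (any⁺ (x ≡ᵇ_) (Any.map (λ { refl → ≡⇒≡ᵇ x x refl }) x∈xs))

search-sound : ∀ k a occ {s} → search k a occ ≡ just s → a ≤ s × s < a + k × s ∉ occ
search-sound (suc k) a occ {s} found with any (a ≡ᵇ_) occ in a-taken
... | true  = let (a<s , s<a+1+k , s∉occ) = search-sound k (suc a) occ found
              in <⇒≤ a<s , subst (s <_) (sym (+-suc a k)) s<a+1+k , s∉occ
search-sound (suc k) a occ refl | false = ≤-refl , m<m+n a z<s , any-≡ᵇ-false⇒∉ a-taken

firstFree-sound : ∀ n a occ {s} → firstFree n a occ ≡ just s → a ≤ s × s ≤ n × s ∉ occ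
firstFree-sound n a occ {s} found with search-sound (suc n ∸ a) a occ found
... | a≤s , s<a+[1+n∸a] , s∉occ = a≤s , s≤n , s∉occ
  where
  s≤n : s ≤ n
  s≤n = ≮⇒≥ λ n<s → <⇒≱ s<a+[1+n∸a]
    (≤-trans (+-monoʳ-≤ a (∸-monoˡ-≤ a n<s)) (≤-reflexive (m+[n∸m]≡n a≤s)))

firstFree-∉ʳ : ∀ n a pre {acc s} → firstFree n a (pre ++ acc) ≡ just s → s ∉ acc
firstFree-∉ʳ n a pre found s∈acc = proj₂ (proj₂ (firstFree-sound n a (pre ++ _) found)) (∈-++⁺ʳ pre s∈acc)

data Run (n t : ℕ) : List ℕ → List ℕ → List ℕ → Set where
  []  : ∀ {occ} → Run n t occ [] []
  _∷_ : ∀ {occ a as s ss} → firstFree n a occ ≡ just s →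
        Run n t (evict t (occ ++ [ s ])) as ss → Run n t occ (a ∷ as) (s ∷ ss)

parks⇒Run : ∀ {n t} occ as → parks n t occ as ≡ true → ∃ (Run n t occ as)
parks⇒Run occ []       _ = [] , []
parks⇒Run {n} {t} occ (a ∷ as) parked with firstFree n a occ in found
... | just s = let (ss , run) = parks⇒Run (evict t (occ ++ [ s ])) as parked in s ∷ ss , found ∷ run

Run⇒Pointwise : ∀ {n t occ as ss} → Run n t occ as ss → Pointwise (λ a s → a ≤ s × s ≤ n) as ss
Run⇒Pointwise []                            = []
Run⇒Pointwise {n} {occ = occ} (found ∷ run) =
  let (a≤s , s≤n , _) = firstFree-sound n _ occ found in (a≤s , s≤n) ∷ Run⇒Pointwise run

Run-drop : ∀ {n t occ as ss} j → Run n t occ as ss → ∃ λ occ′ → Run n t occ′ (drop j as) (drop j ss)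
Run-drop {occ = occ} zero run = occ , run
Run-drop {occ = occ} (suc j) [] = occ , []
Run-drop (suc j) (found ∷ run) = Run-drop j run

evict-keeps-suffix : ∀ t pre acc s → length acc < t →
  ∃ λ pre′ → evict t ((pre ++ acc) ++ [ s ]) ≡ pre′ ++ (acc ++ [ s ])
evict-keeps-suffix t [] acc s acc<t with t <ᵇ length (acc ++ [ s ]) in overfull
... | false = [] , refl
... | true  = contradiction (<ᵇ⇒< t _ (subst T (sym overfull) _))
                (≤⇒≯ (subst (_≤ t) (sym (trans (length-++ acc) (+-comm (length acc) 1))) acc<t))
evict-keeps-suffix t (x ∷ pre) acc s _ with t <ᵇ length (x ∷ (pre ++ acc) ++ [ s ])
... | false = x ∷ pre , cong (x ∷_) (++-assoc pre acc [ s ])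
... | true  = pre , ++-assoc pre acc [ s ]

-- acc holds the spots of the window cars parked so far.  Only the oldest car is ever evicted,
-- so while at most t window cars have parked they are all still present, and the next car
-- avoids their spots.
Run⇒Unique-++-take : ∀ {n t occ as ss} → Run n t occ as ss → ∀ k pre acc → occ ≡ pre ++ acc →
  Unique acc → length acc + k ≤ t → Unique (acc ++ take (suc k) ss)
Run⇒Unique-++-take [] k pre acc _ uacc _ = subst Unique (sym (++-identityʳ acc)) uacc
Run⇒Unique-++-take {n} {as = a ∷ _} (found ∷ run) zero pre acc refl uacc _ =
  Unique-∷ʳ (firstFree-∉ʳ n a pre found) uacc
Run⇒Unique-++-take {n} {t} {as = a ∷ _} {s ∷ ss} (found ∷ run) (suc k) pre acc refl uacc bound
  with pre′ , evicted ← evict-keeps-suffix t pre acc s (<-≤-trans (m<m+n (length acc) z<s) bound) =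
  subst Unique (++-assoc acc [ s ] (take (suc k) ss))
    (Run⇒Unique-++-take run k pre′ (acc ++ [ s ]) evicted (Unique-∷ʳ (firstFree-∉ʳ n a pre found) uacc) bound′)
  where
  bound′ : length (acc ++ [ s ]) + k ≤ t
  bound′ = subst (_≤ t) (sym (trans (cong (_+ k) (length-++ acc)) (+-assoc (length acc) 1 k))) bound

Run⇒Unique-take : ∀ {n t occ as ss} → Run n t occ as ss → Unique (take (suc t) ss)
Run⇒Unique-take {t = t} {occ} run = Run⇒Unique-++-take run t occ [] (sym (++-identityʳ occ)) [] ≤-refl

Run⇒window-beyond≤ : ∀ {n t occ as ss} → Run n t occ as ss → ∀ i j →
  length (filter (∁? (_≤? i)) (take (suc t) (drop j as))) ≤ n ∸ i
Run⇒window-beyond≤ {n} {t} {as = as} {ss} run i j with occ′ , run′ ← Run-drop j run = begin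
  length (filter (∁? (_≤? i)) prefs) ≤⟨ length-filter-mono-Pointwise (∁? (_≤? i)) beyond? parks-beyond
                                          (Pointwise-take (suc t) (Run⇒Pointwise run′)) ⟩
  length (filter beyond? spots)      ≤⟨ unique-interval⇒length≤ (Unique.filter⁺ beyond? (Run⇒Unique-take run′))
                                          (all-filter beyond? spots) ⟩
  n ∸ i                              ∎
  where
  open ≤-Reasoning
  prefs = take (suc t) (drop j as)
  spots = take (suc t) (drop j ss)
  beyond? : Decidable (λ s → i < s × s ≤ n)
  beyond? s = (i <? s) ×-dec (s ≤? n)
  parks-beyond : ∀ {a s} → a ≤ s × s ≤ n → a ≰ i → i < s × s ≤ n
  parks-beyond (a≤s , s≤n) a≰i = <-≤-trans (≰⇒> a≰i) a≤s , s≤n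

proposition2p1 : (t m n : ℕ) → 1 ≤ t → 1 ≤ m → 1 ≤ n → (α : Vec ℕ m) → IsMeteredPF t m n α → (i j : ℕ) → 1 ≤ i → i ≤ n → 1 ≤ j → j ≤ m ∸ t → t + 1 + i ≤ windowCount α t j i + n
proposition2p1 t m n _ _ _ α (_ , parked) i (suc j) _ i≤n (s≤s z≤n) 1+j≤m∸t
  with ss , run ← parks⇒Run [] (toList α) parked = begin
  t + 1 + i                        ≡⟨ cong (_+ i) (+-comm t 1) ⟩
  suc t + i                        ≡⟨ cong (_+ i) (length-take-drop j (suc t) (toList α) in-range) ⟨
  length window + i                ≡⟨ cong (_+ i) (length-filter+length-filter-∁ (_≤? i) window) ⟨
  early + late + i                 ≤⟨ +-monoˡ-≤ i (+-monoʳ-≤ early (Run⇒window-beyond≤ run i j)) ⟩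
  early + (n ∸ i) + i              ≡⟨ +-assoc early (n ∸ i) i ⟩
  early + (n ∸ i + i)              ≡⟨ cong (early +_) (m∸n+n≡m i≤n) ⟩
  early + n                        ≡⟨ cong (_+ n) (windowCount-slice α t j i) ⟨
  windowCount α t (suc j) i + n    ∎
  where
  open ≤-Reasoning
  window = take (suc t) (drop j (toList α))
  early = length (filter (_≤? i) window)
  late = length (filter (∁? (_≤? i)) window)
  in-range : j + suc t ≤ length (toList α)
  in-range = subst (j + suc t ≤_) (sym (length-toList α)) (window-in-range t 1+j≤m∸t)
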